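{- Let $\alpha=(\alpha_1,\dots,\alpha_n)$ be a composition and suppose $1\le r\le n-1$ satisfies $\alpha_r<\alpha_{r+1}$. Let $w\in S_n$ be a permutation in which $r$ appears before $r+1$ (in one-line notation). Then \[x(w)=x(s_rw)\cdot s_r,\] where $x(\cdot)$ is computed with respect to the skyline diagram $D(\alpha)$.
   Context: A composition is a vector of nonnegative integers. The skyline diagram $D(\alpha)$ is the set of boxes $\{(i,j): 1\le i\le n,\ 1\le j\le\alpha_i\}$ (row $i$ consists of its first $\alpha_i$ boxes; rows numbered top to bottom). For $w=w_1\cdots w_n\in S_n$, the filling $\mathcal{F}_w(D)$ of a diagram $D$ is defined column by column: for each column $j$, for $k=1,\dots,n$ in turn, place $w_k$ into the topmost still-empty box of $D$ in column $j$ whose row index is $\ge w_k$, skipping $w_k$ if no such box exists. Then $x(w)=(x_1,\dots,x_n)$ where $x_k$ is the total number of appearances of $k$ in $\mathcal{F}_w(D(\alpha))$. $s_r$ is the transposition $(r,r+1)$; $s_rw$ is the permutation obtained from $w$ by interchanging the values $r$ and $r+1$; for $v\in\mathbb{R}^n$, $v\cdot s_r$ is $v$ with its $r$-th and $(r+1)$-th coordinates swapped. -}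

module Defs where

open import Data.Nat using (ℕ; zero; suc; _≤ᵇ_; _⊔_)
open import Data.Bool using (Bool; true; false; _∧_; not; if_then_else_)
open import Data.Fin using (Fin; toℕ; _≟_)
open import Data.Fin.Permutation using (Permutation′; _⟨$⟩ʳ_)
open import Data.List using (List; []; _∷_; map; sum; allFin; foldr)
open import Data.Maybe using (Maybe; just; nothing)
open import Data.Product using (_×_; _,_; proj₁; proj₂)
open import Relation.Nullary.Decidable using (⌊_⌋)

-- Conventions: values 1..n and rows 1..n are represented by Fin n
-- (the value/row k corresponds to the element of Fin n with toℕ = k - 1).
-- A composition of length n is a function Fin n → ℕ (row i has α i boxes).
-- A permutation w ∈ S_n is a Permutation′ n, with one-line notation
-- w_1 ⋯ w_n given by w ⟨$⟩ʳ 0, …, w ⟨$⟩ʳ (n-1).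

Composition : ℕ → Set
Composition n = Fin n → ℕ

oneLine : ∀ {n} → Permutation′ n → List (Fin n)
oneLine w = map (w ⟨$⟩ʳ_) (allFin _)

topmost : ∀ {n} → (Fin n → Bool) → List (Fin n) → Maybe (Fin n)
topmost p [] = nothing
topmost p (i ∷ is) = if p i then just i else topmost p is

-- State: which boxes of column j are still empty (as a predicate on rows).
-- Output: the list of (row, value) pairs placed in column j.
-- A box (i , j) belongs to D(α) iff j ≤ α i  (columns numbered from 1).
inDiagram : ∀ {n} → Composition n → ℕ → Fin n → Bool
inDiagram α j i = j ≤ᵇ α i

fillColumnFrom : ∀ {n} → Composition n → ℕ → (Fin n → Bool)
               → List (Fin n) → List (Fin n × Fin n)
fillColumnFrom α j empty [] = []
fillColumnFrom {n} α j empty (v ∷ vs)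
  with topmost (λ i → empty i ∧ (toℕ v ≤ᵇ toℕ i)) (allFin n)
... | nothing = fillColumnFrom α j empty vs
... | just i  = (i , v) ∷ fillColumnFrom α j (λ i' → empty i' ∧ not ⌊ i' ≟ i ⌋) vs

fillColumn : ∀ {n} → Composition n → Permutation′ n → ℕ → List (Fin n × Fin n)
fillColumn α w j = fillColumnFrom α j (inDiagram α j) (oneLine w)

countValue : ∀ {n} → Fin n → List (Fin n × Fin n) → ℕ
countValue k [] = 0
countValue k ((_ , v) ∷ ps) = (if ⌊ v ≟ k ⌋ then 1 else 0) + countValue k ps
  where open import Data.Nat using (_+_)

-- largest part of α (the number of nonempty columns of D(α))
maxPart : ∀ {n} → Composition n → ℕ
maxPart {n} α = foldr (λ i m → α i ⊔ m) 0 (allFin n)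

sumColumns : ℕ → (ℕ → ℕ) → ℕ
sumColumns zero f = 0
sumColumns (suc m) f = f (suc m) + sumColumns m f
  where open import Data.Nat using (_+_)

-- x(w) with respect to D(α): x k = number of appearances of k in F_w(D(α))
xVec : ∀ {n} → Composition n → Permutation′ n → Fin n → ℕ
xVec α w k = sumColumns (maxPart α) (λ j → countValue k (fillColumn α w j))

-- Fix a column and run its filling for w and for s_r w side by side, with σ = (r r+1): we show
-- that at every step v is placed by the first run exactly when σ v is placed by the second, so
-- the two columns hold the same values up to σ. Before r is read both runs are identical, and
-- since α_r < α_{r+1} row r+1 is still empty whenever row r is. When r is read, either row r is
-- already full, and from then on r and r+1 behave alike; or r takes row r while r+1 takes row
-- r+1 in the other run, and the two states differ only by swapping rows r and r+1. They merge
-- again as soon as a value lands in the remaining one of these two rows, which happens in both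
-- runs at the same step.

module Submission where

open import Defs
open import Data.Bool using (Bool; true; false; _∧_; not; if_then_else_)
open import Data.Bool.Properties using (∧-zeroʳ; ∧-identityʳ; T-≡)
open import Data.Fin using (Fin; zero; suc; toℕ; _≟_; _<_; _≤_)
open import Data.Fin.Properties using (toℕ-injective; suc-injective; <⇒≢; 0≢1+n)
open import Data.Fin.Permutation
  using (Permutation′; _⟨$⟩ʳ_; _⟨$⟩ˡ_; _∘ₚ_; transpose; inverseˡ; inverseʳ)
open import Data.List using (List; []; _∷_; map; tabulate; allFin)
open import Data.List.Properties using (map-tabulate; map-∘; ∷-injective)
open import Data.List.Relation.Unary.All using (All; []; _∷_)
open import Data.List.Relation.Unary.All.Properties using (tabulate⁺)
open import Data.Maybe using (Maybe; just; nothing) renaming (map to mapᴹ)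
open import Data.Nat as ℕ using (ℕ; suc; _+_; _≤ᵇ_; s≤s)
open import Data.Nat.Properties
  using (_≤?_; <-cmp; ≤-refl; ≤-trans; ≤-pred; <-trans; <⇒≤; <-≤-trans; <⇒≱; ≤ᵇ⇒≤;
         m≤n⇒m<n∨m≡n)
open import Data.Product using (∃-syntax; _×_; _,_; proj₂)
open import Data.Sum using (inj₁; inj₂)
open import Function using (_∘_; id; Equivalence)
open import Function.Definitions using (Injective)
open import Relation.Binary.Definitions using (tri<; tri≈; tri>)
open import Relation.Nullary using (yes; no; contradiction)
open import Relation.Nullary.Decidable using (⌊_⌋; dec-true; dec-false)
open import Relation.Binary.PropositionalEquality

true≢false : true ≢ false
true≢false ()

≤ᵇ-true : ∀ {m n} → m ℕ.≤ n → (m ≤ᵇ n) ≡ true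
≤ᵇ-true {m} {n} = dec-true (m ≤? n)

≤ᵇ-false : ∀ {m n} → n ℕ.< m → (m ≤ᵇ n) ≡ false
≤ᵇ-false {m} {n} = dec-false (m ≤? n) ∘ <⇒≱

≤ᵇ-sound : ∀ {m n} → (m ≤ᵇ n) ≡ true → m ℕ.≤ n
≤ᵇ-sound {m} {n} = ≤ᵇ⇒≤ m n ∘ Equivalence.from T-≡

⌊≟⌋-refl : ∀ {n} (i : Fin n) → ⌊ i ≟ i ⌋ ≡ true
⌊≟⌋-refl i with i ≟ i
... | yes _   = refl
... | no i≢i = contradiction refl i≢i

⌊≟⌋-≢ : ∀ {n} {i j : Fin n} → i ≢ j → ⌊ i ≟ j ⌋ ≡ false
⌊≟⌋-≢ {i = i} {j} i≢j with i ≟ j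
... | yes i≡j = contradiction i≡j i≢j
... | no _    = refl

Rows : ℕ → Set
Rows n = Fin n → Bool

data Topmost {n} (p : Rows n) : Maybe (Fin n) → Set where
  none  : (∀ i → p i ≡ false) → Topmost p nothing
  first : ∀ {i} → p i ≡ true → (∀ j → j < i → p j ≡ false) → Topmost p (just i)

topmost-map : ∀ {m n} (p : Rows n) (f : Fin m → Fin n) (is : List (Fin m)) →
              topmost p (map f is) ≡ mapᴹ f (topmost (p ∘ f) is)
topmost-map p f [] = refl
topmost-map p f (i ∷ is) with p (f i)
... | true  = refl
... | false = topmost-map p f is

Topmost-suc : ∀ {n} {p : Rows (suc n)} {m} →
              p zero ≡ false → Topmost (p ∘ suc) m → Topmost p (mapᴹ suc m)
Topmost-suc p0 (none p∘suc≡false) = none λ { zero → p0 ; (suc i) → p∘suc≡false i }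
Topmost-suc p0 (first pi below) = first pi λ { zero _ → p0 ; (suc j) (s≤s j<i) → below j j<i }

topmost-spec : ∀ {n} (p : Rows n) → Topmost p (topmost p (allFin n))
topmost-spec {ℕ.zero} p = none λ ()
topmost-spec {suc n} p with p zero in p0
... | true  = first p0 λ _ ()
... | false = subst (Topmost p) (sym tail) (Topmost-suc p0 (topmost-spec (p ∘ suc)))
  where
  tail : topmost p (tabulate suc) ≡ mapᴹ suc (topmost (p ∘ suc) (allFin n))
  tail = trans (cong (topmost p) (sym (map-tabulate id suc))) (topmost-map p suc (allFin n))

Topmost-unique : ∀ {n} {p : Rows n} {m m′} → Topmost p m → Topmost p m′ → m ≡ m′
Topmost-unique (none _) (none _) = refl
Topmost-unique (none p≡false) (first pi _) = contradiction (trans (sym pi) (p≡false _)) true≢false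
Topmost-unique (first pi _) (none p≡false) = contradiction (trans (sym pi) (p≡false _)) true≢false
Topmost-unique (first {i} pi below) (first {i′} pi′ below′) with <-cmp (toℕ i) (toℕ i′)
... | tri< i<i′ _ _ = contradiction (trans (sym pi) (below′ i i<i′)) true≢false
... | tri≈ _ i≡i′ _ = cong just (toℕ-injective i≡i′)
... | tri> _ _ i′<i = contradiction (trans (sym pi′) (below i′ i′<i)) true≢false

topmost-allFin : ∀ {n} {p : Rows n} {m} → Topmost p m → topmost p (allFin n) ≡ m
topmost-allFin = Topmost-unique (topmost-spec _)

Topmost-cong : ∀ {n} {p q : Rows n} {m} → p ≗ q → Topmost p m → Topmost q m
Topmost-cong p≗q (none p≡false) = none λ i → trans (sym (p≗q i)) (p≡false i)
Topmost-cong p≗q (first pi below) =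
  first (trans (sym (p≗q _)) pi) λ j j<i → trans (sym (p≗q j)) (below j j<i)

-- A row set E marks the still empty rows of a column. Both definitions match fillColumnFrom
-- literally, so its `with` reduces along them.
eligible : ∀ {n} → Rows n → Fin n → Rows n
eligible E v i = E i ∧ (toℕ v ≤ᵇ toℕ i)

remove : ∀ {n} → Rows n → Fin n → Rows n
remove E i i′ = E i′ ∧ not ⌊ i′ ≟ i ⌋

module _ {n} (E : Rows n) (v : Fin n) where

  eligible-intro : ∀ {i} → E i ≡ true → v ≤ i → eligible E v i ≡ true
  eligible-intro {i} Ei≡true v≤i rewrite Ei≡true = ≤ᵇ-true {toℕ v} {toℕ i} v≤i

  eligible-above : ∀ {i} → v ≤ i → eligible E v i ≡ E i
  eligible-above {i} v≤i =
    trans (cong (E i ∧_) (≤ᵇ-true {toℕ v} {toℕ i} v≤i)) (∧-identityʳ (E i))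

  eligible-below : ∀ {i} → i < v → eligible E v i ≡ false
  eligible-below {i} i<v = trans (cong (E i ∧_) (≤ᵇ-false i<v)) (∧-zeroʳ (E i))

  eligible-false : ∀ {i} → E i ≡ false → eligible E v i ≡ false
  eligible-false Ei≡false = cong (_∧ _) Ei≡false

  eligible-≤ : ∀ {i} → eligible E v i ≡ true → v ≤ i
  eligible-≤ {i} eligible≡true with E i
  ... | true = ≤ᵇ-sound {toℕ v} eligible≡true

  Topmost-eligible-self : E v ≡ true → Topmost (eligible E v) (just v)
  Topmost-eligible-self Ev≡true = first (eligible-intro Ev≡true ≤-refl) λ _ → eligible-below

eligible-cong : ∀ {n} {E E′ : Rows n} v → E ≗ E′ → eligible E v ≗ eligible E′ v
eligible-cong v E≗E′ i = cong (_∧ _) (E≗E′ i)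

module _ {n} (E : Rows n) where

  remove-self : ∀ {i} → remove E i i ≡ false
  remove-self {i} = trans (cong (λ b → E i ∧ not b) (⌊≟⌋-refl i)) (∧-zeroʳ (E i))

  remove-other : ∀ {i i′} → i′ ≢ i → remove E i i′ ≡ E i′
  remove-other {i} {i′} i′≢i =
    trans (cong (λ b → E i′ ∧ not b) (⌊≟⌋-≢ i′≢i)) (∧-identityʳ (E i′))

  remove-intro : ∀ {i i′} → E i′ ≡ true → i′ ≢ i → remove E i i′ ≡ true
  remove-intro Ei′≡true i′≢i = trans (remove-other i′≢i) Ei′≡true

  remove-false : ∀ {i i′} → E i′ ≡ false → remove E i i′ ≡ false
  remove-false Ei′≡false = cong (_∧ _) Ei′≡false

  remove-empty : ∀ {i i′} → remove E i i′ ≡ true → E i′ ≡ true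
  remove-empty {i′ = i′} remove≡true with E i′
  ... | true = refl

remove-cong : ∀ {n} {E E′ : Rows n} i → E ≗ E′ → remove E i ≗ remove E′ i
remove-cong i E≗E′ i′ = cong (_∧ _) (E≗E′ i′)

⟨$⟩ʳ-injective : ∀ {n} (π : Permutation′ n) → Injective _≡_ _≡_ (π ⟨$⟩ʳ_)
⟨$⟩ʳ-injective π πa≡πb =
  trans (sym (inverseˡ π)) (trans (cong (π ⟨$⟩ˡ_) πa≡πb) (inverseˡ π))

⌊≟⌋-permute : ∀ {n} (π : Permutation′ n) (v k : Fin n) →
              ⌊ v ≟ k ⌋ ≡ ⌊ π ⟨$⟩ʳ v ≟ π ⟨$⟩ʳ k ⌋
⌊≟⌋-permute π v k with v ≟ k
... | yes refl = sym (⌊≟⌋-refl (π ⟨$⟩ʳ v))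
... | no v≢k   = sym (⌊≟⌋-≢ (v≢k ∘ ⟨$⟩ʳ-injective π))

countValue-permute : ∀ {n} (π : Permutation′ n) (k : Fin n) (ps qs : List (Fin n × Fin n)) →
                     map (π ⟨$⟩ʳ_) (map proj₂ ps) ≡ map proj₂ qs →
                     countValue k ps ≡ countValue (π ⟨$⟩ʳ k) qs
countValue-permute π k [] [] _ = refl
countValue-permute π k ((_ , v) ∷ ps) ((_ , v′) ∷ qs) eq with ∷-injective eq
... | refl , eq′ = cong₂ _+_ (cong (λ b → if b then 1 else 0) (⌊≟⌋-permute π v k))
                             (countValue-permute π k ps qs eq′)

oneLine-∘ₚ : ∀ {n} (w π : Permutation′ n) → oneLine (w ∘ₚ π) ≡ map (π ⟨$⟩ʳ_) (oneLine w)
oneLine-∘ₚ w π = map-∘ (allFin _)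

inDiagram-mono : ∀ {n} (α : Composition n) {i i′} j →
                 α i ℕ.≤ α i′ → inDiagram α j i ≡ true → inDiagram α j i′ ≡ true
inDiagram-mono α j αi≤αi′ j≤αi = ≤ᵇ-true (≤-trans (≤ᵇ-sound {j} j≤αi) αi≤αi′)

sumColumns-cong : ∀ m {f g : ℕ → ℕ} → f ≗ g → sumColumns m f ≡ sumColumns m g
sumColumns-cong ℕ.zero f≗g = refl
sumColumns-cong (suc m) f≗g = cong₂ _+_ (f≗g (suc m)) (sumColumns-cong m f≗g)

module Column {n} (α : Composition n) (j : ℕ) (r r′ : Fin n) (r′≡1+r : toℕ r′ ≡ suc (toℕ r))
  where

  σ : Fin n → Fin n
  σ = transpose r r′ ⟨$⟩ʳ_

  r<r′ : r < r′
  r<r′ = subst (toℕ r ℕ.<_) (sym r′≡1+r) ≤-refl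

  r≢r′ : r ≢ r′
  r≢r′ = <⇒≢ r<r′

  r′≢r : r′ ≢ r
  r′≢r = ≢-sym r≢r′

  σ-r : σ r ≡ r′
  σ-r rewrite dec-true (r ≟ r) refl = refl

  σ-r′ : σ r′ ≡ r
  σ-r′ rewrite dec-false (r′ ≟ r) r′≢r | dec-true (r′ ≟ r′) refl = refl

  σ-fix : ∀ {v} → v ≢ r → v ≢ r′ → σ v ≡ v
  σ-fix {v} v≢r v≢r′ rewrite dec-false (v ≟ r) v≢r | dec-false (v ≟ r′) v≢r′ = refl

  data Position : Fin n → Set where
    below : ∀ {v} → v < r → Position v
    at-r  : Position r
    at-r′ : Position r′
    above : ∀ {v} → r′ < v → Position v

  position : ∀ v → Position v
  position v with <-cmp (toℕ v) (toℕ r)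
  ... | tri< v<r _ _ = below v<r
  ... | tri≈ _ v≡r _ rewrite toℕ-injective v≡r = at-r
  ... | tri> _ _ r<v with m≤n⇒m<n∨m≡n (subst (ℕ._≤ toℕ v) (sym r′≡1+r) r<v)
  ...   | inj₁ r′<v = above r′<v
  ...   | inj₂ r′≡v rewrite toℕ-injective r′≡v = at-r′

  below-≢r : ∀ {v} → v < r → v ≢ r
  below-≢r = <⇒≢

  below-≢r′ : ∀ {v} → v < r → v ≢ r′
  below-≢r′ v<r = <⇒≢ (<-trans v<r r<r′)

  above-≢r : ∀ {v} → r′ < v → v ≢ r
  above-≢r r′<v = ≢-sym (<⇒≢ (<-trans r<r′ r′<v))

  above-≢r′ : ∀ {v} → r′ < v → v ≢ r′
  above-≢r′ r′<v = ≢-sym (<⇒≢ r′<v)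

  σ-below : ∀ {v} → v < r → σ v ≡ v
  σ-below v<r = σ-fix (below-≢r v<r) (below-≢r′ v<r)

  σ-above : ∀ {v} → r′ < v → σ v ≡ v
  σ-above r′<v = σ-fix (above-≢r r′<v) (above-≢r′ r′<v)

  ≤r′⇒≤r : ∀ {v} → v ≤ r′ → v ≢ r′ → v ≤ r
  ≤r′⇒≤r v≤r′ v≢r′ with m≤n⇒m<n∨m≡n v≤r′
  ... | inj₁ v<r′ = ≤-pred (subst (suc (toℕ _) ℕ.≤_) r′≡1+r v<r′)
  ... | inj₂ v≡r′ = contradiction (toℕ-injective v≡r′) v≢r′

  eligible-r′≗r : ∀ {E} → E r ≡ false → eligible E r′ ≗ eligible E r
  eligible-r′≗r {E} Er≡false i with position i
  ... | below i<r  = trans (eligible-below E r′ (<-trans i<r r<r′)) (sym (eligible-below E r i<r))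
  ... | at-r       = trans (eligible-false E r′ Er≡false) (sym (eligible-false E r Er≡false))
  ... | at-r′      = trans (eligible-above E r′ ≤-refl) (sym (eligible-above E r (<⇒≤ r<r′)))
  ... | above r′<i = trans (eligible-above E r′ (<⇒≤ r′<i))
                           (sym (eligible-above E r (<⇒≤ (<-trans r<r′ r′<i))))

  eligible-σ : ∀ {E} v → E r ≡ false → eligible E v ≗ eligible E (σ v)
  eligible-σ {E} v Er≡false i with position v
  ... | below v<r  = cong (λ u → eligible E u i) (sym (σ-below v<r))
  ... | at-r       = trans (sym (eligible-r′≗r Er≡false i)) (cong (λ u → eligible E u i) (sym σ-r))
  ... | at-r′      = trans (eligible-r′≗r Er≡false i) (cong (λ u → eligible E u i) (sym σ-r′))
  ... | above r′<v = cong (λ u → eligible E u i) (sym (σ-above r′<v))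

  Topmost-σ : ∀ {E} v {u m} → σ v ≡ u → Topmost (eligible E u) m → Topmost (eligible E (σ v)) m
  Topmost-σ {E} v {m = m} σv≡u = subst (λ x → Topmost (eligible E x) m) (sym σv≡u)

  placed : Rows n → List (Fin n) → List (Fin n)
  placed E vs = map proj₂ (fillColumnFrom α j E vs)

  Simulates : Rows n → Rows n → List (Fin n) → Set
  Simulates E E′ vs = map σ (placed E vs) ≡ placed E′ (map σ vs)

  module _ {E E′ : Rows n} {v : Fin n} {vs : List (Fin n)} where

    simulate-skip : Topmost (eligible E v) nothing → Topmost (eligible E′ (σ v)) nothing →
                    Simulates E E′ vs → Simulates E E′ (v ∷ vs)
    simulate-skip t t′ sim rewrite topmost-allFin t | topmost-allFin t′ = sim

    simulate-place : ∀ {i i′} →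
                     Topmost (eligible E v) (just i) → Topmost (eligible E′ (σ v)) (just i′) →
                     Simulates (remove E i) (remove E′ i′) vs → Simulates E E′ (v ∷ vs)
    simulate-place t t′ sim rewrite topmost-allFin t | topmost-allFin t′ = cong (σ v ∷_) sim

    simulate-same-rows : eligible E v ≗ eligible E′ (σ v) → Simulates E E′ vs →
                         (∀ {i} → Topmost (eligible E v) (just i) →
                                  Simulates (remove E i) (remove E′ i) vs) →
                         Simulates E E′ (v ∷ vs)
    simulate-same-rows same-rows skip place = step (topmost-spec (eligible E v))
      where
      step : ∀ {m} → Topmost (eligible E v) m → Simulates E E′ (v ∷ vs)
      step t@(none _)    = simulate-skip t (Topmost-cong same-rows t) skip
      step t@(first _ _) = simulate-place t (Topmost-cong same-rows t) (place t)

  simulate-agreeing : ∀ {E E′} vs → E ≗ E′ → E r ≡ false → Simulates E E′ vs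
  simulate-agreeing [] _ _ = refl
  simulate-agreeing {E} {E′} (v ∷ vs) E≗E′ Er≡false =
    simulate-same-rows same-rows (simulate-agreeing vs E≗E′ Er≡false)
      λ {i} _ → simulate-agreeing vs (remove-cong i E≗E′) (remove-false E Er≡false)
    where
    same-rows : eligible E v ≗ eligible E′ (σ v)
    same-rows i = trans (eligible-cong v E≗E′ i) (eligible-σ v (trans (sym (E≗E′ r)) Er≡false) i)

  record Swapped (E E′ : Rows n) : Set where
    field
      E-r   : E r ≡ false
      E-r′  : E r′ ≡ true
      E′-r  : E′ r ≡ true
      E′-r′ : E′ r′ ≡ false
      agree : ∀ i → i ≢ r → i ≢ r′ → E i ≡ E′ i

  open Swapped

  Swapped-after-r : ∀ {E} → E r ≡ true → E r′ ≡ true → Swapped (remove E r) (remove E r′)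
  Swapped-after-r {E} Er Er′ = record
    { E-r   = remove-self E
    ; E-r′  = remove-intro E Er′ r′≢r
    ; E′-r  = remove-intro E Er r≢r′
    ; E′-r′ = remove-self E
    ; agree = λ i i≢r i≢r′ → trans (remove-other E i≢r) (sym (remove-other E i≢r′))
    }

  Swapped-remove : ∀ {E E′ i} → Swapped E E′ → i ≢ r → i ≢ r′ →
                   Swapped (remove E i) (remove E′ i)
  Swapped-remove {E} {E′} sw i≢r i≢r′ = record
    { E-r   = remove-false E (E-r sw)
    ; E-r′  = remove-intro E (E-r′ sw) (≢-sym i≢r′)
    ; E′-r  = remove-intro E′ (E′-r sw) (≢-sym i≢r)
    ; E′-r′ = remove-false E′ (E′-r′ sw)
    ; agree = λ i′ i′≢r i′≢r′ → cong (_∧ _) (agree sw i′ i′≢r i′≢r′)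
    }

  Swapped-merge : ∀ {E E′} → Swapped E E′ → remove E r′ ≗ remove E′ r
  Swapped-merge {E} {E′} sw i = by-position (position i)
    where
    elsewhere : ∀ {i} → i ≢ r → i ≢ r′ → remove E r′ i ≡ remove E′ r i
    elsewhere i≢r i≢r′ =
      trans (remove-other E i≢r′) (trans (agree sw _ i≢r i≢r′) (sym (remove-other E′ i≢r)))
    by-position : ∀ {i} → Position i → remove E r′ i ≡ remove E′ r i
    by-position (below i<r)  = elsewhere (below-≢r i<r) (below-≢r′ i<r)
    by-position at-r         = trans (remove-false E (E-r sw)) (sym (remove-self E′))
    by-position at-r′        = trans (remove-self E) (sym (remove-false E′ (E′-r′ sw)))
    by-position (above r′<i) = elsewhere (above-≢r r′<i) (above-≢r′ r′<i)

  Swapped-eligible-above : ∀ {E E′ v} → Swapped E E′ → r′ < v → eligible E v ≗ eligible E′ v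
  Swapped-eligible-above {E} {E′} {v} sw r′<v i = by-position (position i)
    where
    both-below : ∀ {i} → i < v → eligible E v i ≡ eligible E′ v i
    both-below i<v = trans (eligible-below E v i<v) (sym (eligible-below E′ v i<v))
    by-position : ∀ {i} → Position i → eligible E v i ≡ eligible E′ v i
    by-position (below i<r)  = both-below (<-trans i<r (<-trans r<r′ r′<v))
    by-position at-r         = both-below (<-trans r<r′ r′<v)
    by-position at-r′        = both-below r′<v
    by-position (above r′<i) = cong (_∧ _) (agree sw _ (above-≢r r′<i) (above-≢r′ r′<i))

  simulate-merge : ∀ {E E′ v vs} → Swapped E E′ →
                   Topmost (eligible E v) (just r′) → Topmost (eligible E′ (σ v)) (just r) →
                   Simulates E E′ (v ∷ vs)
  simulate-merge {E} {vs = vs} sw t t′ =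
    simulate-place t t′ (simulate-agreeing vs (Swapped-merge sw) (remove-false E (E-r sw)))

  module _ {vs : List (Fin n)} (simulate-vs : ∀ {F F′} → Swapped F F′ → Simulates F F′ vs) where

    swapped-above : ∀ {E E′ v} → Swapped E E′ → r′ < v → Simulates E E′ (v ∷ vs)
    swapped-above {E} {E′} {v} sw r′<v = simulate-same-rows same-rows (simulate-vs sw) place
      where
      same-rows : eligible E v ≗ eligible E′ (σ v)
      same-rows i = trans (Swapped-eligible-above sw r′<v i)
                          (cong (λ u → eligible E′ u i) (sym (σ-above r′<v)))
      place : ∀ {i} → Topmost (eligible E v) (just i) → Simulates (remove E i) (remove E′ i) vs
      place {i} (first Ei _) = simulate-vs (Swapped-remove sw (above-≢r r′<i) (above-≢r′ r′<i))
        where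
        r′<i : r′ < i
        r′<i = <-≤-trans r′<v (eligible-≤ E v Ei)

    -- Row r′ is eligible for v, so v lands either above row r, where the two states agree,
    -- or in row r′, in which case σ v = v lands in row r of the other state.
    swapped-below : ∀ {E E′ v} → Swapped E E′ → v < r → Simulates E E′ (v ∷ vs)
    swapped-below {E} {E′} {v} sw v<r = step (topmost-spec (eligible E v))
      where
      r′-eligible : eligible E v r′ ≡ true
      r′-eligible = eligible-intro E v (E-r′ sw) (<⇒≤ (<-trans v<r r<r′))
      agree-below : ∀ {i} → i < r → eligible E v i ≡ eligible E′ v i
      agree-below i<r = cong (_∧ _) (agree sw _ (below-≢r i<r) (below-≢r′ i<r))
      topmost-other : ∀ {i} → i ≤ r → eligible E′ v i ≡ true →
                      (∀ k → k < i → eligible E v k ≡ false) → Topmost (eligible E′ (σ v)) (just i)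
      topmost-other i≤r E′i below-i = Topmost-σ v (σ-below v<r)
        (first E′i λ k k<i → trans (sym (agree-below (<-≤-trans k<i i≤r))) (below-i k k<i))
      step : ∀ {m} → Topmost (eligible E v) m → Simulates E E′ (v ∷ vs)
      step (none no-row) = contradiction (trans (sym r′-eligible) (no-row r′)) true≢false
      step t@(first {i} Ei below-i) with position i
      ... | below i<r  =
        simulate-place t (topmost-other (<⇒≤ i<r) (trans (sym (agree-below i<r)) Ei) below-i)
          (simulate-vs (Swapped-remove sw (below-≢r i<r) (below-≢r′ i<r)))
      ... | at-r       = contradiction (trans (sym Ei) (eligible-false E v (E-r sw))) true≢false
      ... | at-r′      =
        simulate-merge sw t (topmost-other ≤-refl (eligible-intro E′ v (E′-r sw) (<⇒≤ v<r))
                                           λ k k<r → below-i k (<-trans k<r r<r′))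
      ... | above r′<i = contradiction (trans (sym r′-eligible) (below-i r′ r′<i)) true≢false

  simulate-swapped : ∀ {E E′} vs → All (_≢ r) vs → Swapped E E′ → Simulates E E′ vs
  simulate-swapped [] [] _ = refl
  simulate-swapped {E} {E′} (v ∷ vs) (v≢r ∷ vs≢r) sw with position v
  ... | below v<r  = swapped-below (simulate-swapped vs vs≢r) sw v<r
  ... | at-r       = contradiction refl v≢r
  ... | at-r′      = simulate-merge sw (Topmost-eligible-self E r′ (E-r′ sw))
                                       (Topmost-σ r′ σ-r′ (Topmost-eligible-self E′ r (E′-r sw)))
  ... | above r′<v = swapped-above (simulate-swapped vs vs≢r) sw r′<v

  data RBeforeR′ : List (Fin n) → Set where
    []   : RBeforeR′ []
    skip : ∀ {v vs} → v ≢ r → v ≢ r′ → RBeforeR′ vs → RBeforeR′ (v ∷ vs)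
    r∷_  : ∀ {vs} → All (_≢ r) vs → RBeforeR′ (r ∷ vs)

  before-skip : ∀ {E v vs} → v ≢ r → v ≢ r′ → (E r ≡ true → E r′ ≡ true) →
                (∀ {F} → (F r ≡ true → F r′ ≡ true) → Simulates F F vs) →
                Simulates E E (v ∷ vs)
  before-skip {E} {v} {vs} v≢r v≢r′ r⇒r′ simulate-vs =
    simulate-same-rows same-rows (simulate-vs r⇒r′) place
    where
    same-rows : eligible E v ≗ eligible E (σ v)
    same-rows i = cong (λ u → eligible E u i) (sym (σ-fix v≢r v≢r′))
    place : ∀ {i} → Topmost (eligible E v) (just i) → Simulates (remove E i) (remove E i) vs
    place {i} (first Ei below-i) = simulate-vs r⇒r′-after
      where
      -- v ≤ r, so an empty row r would have been taken before row r′.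
      i≢r′ : E r ≡ true → i ≢ r′
      i≢r′ Er i≡r′ =
        contradiction (trans (sym (eligible-intro E v Er v≤r)) (below-i r r<i)) true≢false
        where
        v≤r : v ≤ r
        v≤r = ≤r′⇒≤r (subst (v ≤_) i≡r′ (eligible-≤ E v Ei)) v≢r′
        r<i : r < i
        r<i = subst (r <_) (sym i≡r′) r<r′
      r⇒r′-after : remove E i r ≡ true → remove E i r′ ≡ true
      r⇒r′-after removed-r = remove-intro E (r⇒r′ Er) (≢-sym (i≢r′ Er))
        where
        Er : E r ≡ true
        Er = remove-empty E removed-r

  simulate-before : ∀ {E} vs → RBeforeR′ vs → (E r ≡ true → E r′ ≡ true) → Simulates E E vs
  simulate-before [] [] _ = refl
  simulate-before (v ∷ vs) (skip v≢r v≢r′ ok) r⇒r′ =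
    before-skip v≢r v≢r′ r⇒r′ (simulate-before vs ok)
  simulate-before {E} (_ ∷ vs) (r∷ vs≢r) r⇒r′ with E r in Er
  ... | true  = simulate-place (Topmost-eligible-self E r Er)
                  (Topmost-σ r σ-r (Topmost-eligible-self E r′ Er′))
                  (simulate-swapped vs vs≢r (Swapped-after-r Er Er′))
    where
    Er′ : E r′ ≡ true
    Er′ = r⇒r′ refl
  ... | false = simulate-agreeing (r ∷ vs) (λ _ → refl) Er

  tabulate-RBeforeR′ : ∀ {m} (f : Fin m → Fin n) → Injective _≡_ _≡_ f →
                       (∀ i → f i ≡ r′ → ∃[ i′ ] i′ < i × f i′ ≡ r) → RBeforeR′ (tabulate f)
  tabulate-RBeforeR′ {ℕ.zero} f _ _ = []
  tabulate-RBeforeR′ {suc m} f f-injective r-first with f zero ≟ r | f zero ≟ r′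
  ... | yes f0≡r | _ = subst (λ x → RBeforeR′ (x ∷ tabulate (f ∘ suc))) (sym f0≡r)
                         (r∷ tabulate⁺ λ i fi≡r → 0≢1+n (f-injective (trans f0≡r (sym fi≡r))))
  ... | no _ | yes f0≡r′ with r-first zero f0≡r′
  ...   | _ , () , _
  tabulate-RBeforeR′ {suc m} f f-injective r-first | no f0≢r | no f0≢r′ =
    skip f0≢r f0≢r′ (tabulate-RBeforeR′ (f ∘ suc) (suc-injective ∘ f-injective) r-first′)
    where
    r-first′ : ∀ i → f (suc i) ≡ r′ → ∃[ i′ ] i′ < i × f (suc i′) ≡ r
    r-first′ i fi≡r′ with r-first (suc i) fi≡r′
    ... | zero , _ , f0≡r = contradiction f0≡r f0≢r
    ... | suc i′ , s≤s i′<i , fi′≡r = i′ , i′<i , fi′≡r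

  oneLine-RBeforeR′ : (w : Permutation′ n) → w ⟨$⟩ˡ r < w ⟨$⟩ˡ r′ → RBeforeR′ (oneLine w)
  oneLine-RBeforeR′ w r-first = subst RBeforeR′ (sym (map-tabulate id (w ⟨$⟩ʳ_)))
    (tabulate-RBeforeR′ (w ⟨$⟩ʳ_) (⟨$⟩ʳ-injective w) λ i wi≡r′ →
      w ⟨$⟩ˡ r , subst (w ⟨$⟩ˡ r <_) (position-r′ i wi≡r′) r-first , inverseʳ w)
    where
    position-r′ : ∀ i → w ⟨$⟩ʳ i ≡ r′ → w ⟨$⟩ˡ r′ ≡ i
    position-r′ i wi≡r′ = trans (cong (w ⟨$⟩ˡ_) (sym wi≡r′)) (inverseˡ w)

proposition4p4 : ∀ {n} (α : Composition n) (r r′ : Fin n) → toℕ r′ ≡ suc (toℕ r)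
    → α r ℕ.< α r′ → (w : Permutation′ n) → toℕ (w ⟨$⟩ˡ r) ℕ.< toℕ (w ⟨$⟩ˡ r′)
    → ∀ k → xVec α w k ≡ xVec α (w ∘ₚ transpose r r′) (transpose r r′ ⟨$⟩ʳ k)
proposition4p4 {n} α r r′ r′≡1+r αr<αr′ w r-first k = sumColumns-cong (maxPart α) column
  where
  column : ∀ j → countValue k (fillColumn α w j)
               ≡ countValue (transpose r r′ ⟨$⟩ʳ k) (fillColumn α (w ∘ₚ transpose r r′) j)
  column j = countValue-permute (transpose r r′) k _ _ (begin
    map σ (placed D (oneLine w))
      ≡⟨ simulate-before (oneLine w) (oneLine-RBeforeR′ w r-first) (inDiagram-mono α j (<⇒≤ αr<αr′)) ⟩
    placed D (map σ (oneLine w))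
      ≡⟨ cong (placed D) (oneLine-∘ₚ w (transpose r r′)) ⟨
    placed D (oneLine (w ∘ₚ transpose r r′)) ∎)
    where
    open Column α j r r′ r′≡1+r
    open ≡-Reasoning
    D : Rows n
    D = inDiagram α j
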